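{- Let $\Pi$ be a projective plane in which Desargues' theorem holds, and let $P_0P_1P_2P_3$ be a complete quadrangle in $\Pi$ whose diagonal points $D_1,D_2,D_3$ are noncollinear. Then there exists a complete quadrilateral $p_0p_1p_2p_3$ in $\Pi$, with diagonal lines $d_1,d_2,d_3$, such that $d_1=D_2D_3$, $d_2=D_3D_1$, $d_3=D_1D_2$; that is, $P_0P_1P_2P_3$ and $p_0p_1p_2p_3$ form a quadrangle-quadrilateral configuration. Dually, if $p_0p_1p_2p_3$ is a complete quadrilateral in $\Pi$ whose diagonal lines are nonconcurrent, then there exists a complete quadrangle forming a quadrangle-quadrilateral configuration with it.
   Context: Notation: for distinct points $A,B$, $AB$ denotes the line joining them; for distinct lines $a,b$, $a\cdot b$ denotes their intersection point. A complete quadrangle $P_0P_1P_2P_3$ consists of four points, no three collinear; its diagonal points are $D_1 = P_0P_1\cdot P_2P_3$, $D_2 = P_0P_2\cdot P_3P_1$, $D_3 = P_0P_3\cdot P_1P_2$. A complete quadrilateral $p_0p_1p_2p_3$ consists of four lines, no three concurrent; its diagonal lines are $d_1=(p_0\cdot p_1)(p_2\cdot p_3)$, $d_2=(p_0\cdot p_2)(p_3\cdot p_1)$, $d_3=(p_0\cdot p_3)(p_1\cdot p_2)$. A quadrangle-quadrilateral configuration is a complete quadrangle and a complete quadrilateral, with diagonal points $D_i$ and diagonal lines $d_i$ respectively, such that $d_1=D_2D_3$, $d_2=D_3D_1$, $d_3=D_1D_2$. -}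

module Defs where

open import Level using (Level; suc; _⊔_)
open import Data.Product using (Σ; ∃; ∃-syntax; _×_; _,_)
open import Relation.Binary.PropositionalEquality using (_≡_; _≢_)
open import Relation.Nullary using (¬_)

record ProjectivePlane (ℓ : Level) : Set (suc ℓ) where
  field
    Point : Set ℓ
    Line  : Set ℓ
    _I_   : Point → Line → Set ℓ
    join        : (A B : Point) → A ≢ B → ∃[ l ] (A I l × B I l)
    join-unique : (A B : Point) → A ≢ B → (l m : Line) →
                  A I l → B I l → A I m → B I m → l ≡ m
    meet        : (l m : Line) → l ≢ m → ∃[ X ] (X I l × X I m)
    meet-unique : (l m : Line) → l ≢ m → (X Y : Point) →
                  X I l → X I m → Y I l → Y I m → X ≡ Y
    nondegenerate :
      ∃[ A ] ∃[ B ] ∃[ C ] ∃[ D ]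
        (¬ (∃[ l ] (A I l × B I l × C I l)) ×
         ¬ (∃[ l ] (A I l × B I l × D I l)) ×
         ¬ (∃[ l ] (A I l × C I l × D I l)) ×
         ¬ (∃[ l ] (B I l × C I l × D I l)))

module _ {ℓ : Level} (Π : ProjectivePlane ℓ) where
  open ProjectivePlane Π

  Collinear : Point → Point → Point → Set ℓ
  Collinear A B C = ∃[ l ] (A I l × B I l × C I l)

  Collinear4 : Point → Point → Point → Point → Set ℓ
  Collinear4 A B C D = ∃[ l ] (A I l × B I l × C I l × D I l)

  Concurrent : Line → Line → Line → Set ℓ
  Concurrent a b c = ∃[ X ] (X I a × X I b × X I c)

  IsMeetOfJoins : Point → Point → Point → Point → Point → Set ℓ
  IsMeetOfJoins X A B C D =
    ∃[ l ] ∃[ m ] (A I l × B I l × C I m × D I m × X I l × X I m)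

  IsJoinOfMeets : Line → Line → Line → Line → Line → Set ℓ
  IsJoinOfMeets d a b c e =
    ∃[ X ] ∃[ Y ] (X I a × X I b × Y I c × Y I e × X I d × Y I d)

  IsQuadrangle : Point → Point → Point → Point → Set ℓ
  IsQuadrangle P₀ P₁ P₂ P₃ =
    ¬ Collinear P₀ P₁ P₂ × ¬ Collinear P₀ P₁ P₃ ×
    ¬ Collinear P₀ P₂ P₃ × ¬ Collinear P₁ P₂ P₃

  IsQuadrilateral : Line → Line → Line → Line → Set ℓ
  IsQuadrilateral p₀ p₁ p₂ p₃ =
    ¬ Concurrent p₀ p₁ p₂ × ¬ Concurrent p₀ p₁ p₃ ×
    ¬ Concurrent p₀ p₂ p₃ × ¬ Concurrent p₁ p₂ p₃

  AreDiagonalPoints : Point → Point → Point → Point → Point → Point → Point → Set ℓ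
  AreDiagonalPoints P₀ P₁ P₂ P₃ D₁ D₂ D₃ =
    IsMeetOfJoins D₁ P₀ P₁ P₂ P₃ ×
    IsMeetOfJoins D₂ P₀ P₂ P₃ P₁ ×
    IsMeetOfJoins D₃ P₀ P₃ P₁ P₂

  AreDiagonalLines : Line → Line → Line → Line → Line → Line → Line → Set ℓ
  AreDiagonalLines p₀ p₁ p₂ p₃ d₁ d₂ d₃ =
    IsJoinOfMeets d₁ p₀ p₁ p₂ p₃ ×
    IsJoinOfMeets d₂ p₀ p₂ p₃ p₁ ×
    IsJoinOfMeets d₃ p₀ p₃ p₁ p₂

  -- d₁ = D₂D₃, d₂ = D₃D₁, d₃ = D₁D₂ (as incidences; the D's are distinct
  -- whenever they are noncollinear, so the joining line is unique)
  DiagonalMatch : Point → Point → Point → Line → Line → Line → Set ℓ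
  DiagonalMatch D₁ D₂ D₃ d₁ d₂ d₃ =
    (D₂ I d₁ × D₃ I d₁) × (D₃ I d₂ × D₁ I d₂) × (D₁ I d₃ × D₂ I d₃)

  IsQQConfiguration : Point → Point → Point → Point →
                      Line → Line → Line → Line → Set ℓ
  IsQQConfiguration P₀ P₁ P₂ P₃ p₀ p₁ p₂ p₃ =
    IsQuadrangle P₀ P₁ P₂ P₃ × IsQuadrilateral p₀ p₁ p₂ p₃ ×
    ∃[ D₁ ] ∃[ D₂ ] ∃[ D₃ ] ∃[ d₁ ] ∃[ d₂ ] ∃[ d₃ ]
      (AreDiagonalPoints P₀ P₁ P₂ P₃ D₁ D₂ D₃ ×
       AreDiagonalLines p₀ p₁ p₂ p₃ d₁ d₂ d₃ ×
       DiagonalMatch D₁ D₂ D₃ d₁ d₂ d₃)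

  -- Desargues' theorem: two triangles perspective from a point O
  -- (with Aᵢ ≠ Bᵢ and corresponding sides distinct) are perspective
  -- from a line.
  Desarguesian : Set ℓ
  Desarguesian =
    (O A₁ A₂ A₃ B₁ B₂ B₃ : Point) →
    ¬ Collinear A₁ A₂ A₃ → ¬ Collinear B₁ B₂ B₃ →
    A₁ ≢ B₁ → A₂ ≢ B₂ → A₃ ≢ B₃ →
    Collinear O A₁ B₁ → Collinear O A₂ B₂ → Collinear O A₃ B₃ →
    ¬ Collinear4 A₁ A₂ B₁ B₂ → ¬ Collinear4 A₂ A₃ B₂ B₃ →
    ¬ Collinear4 A₃ A₁ B₃ B₁ →
    (X Y Z : Point) →
    IsMeetOfJoins X A₁ A₂ B₁ B₂ →
    IsMeetOfJoins Y A₂ A₃ B₂ B₃ →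
    IsMeetOfJoins Z A₃ A₁ B₃ B₁ →
    Collinear X Y Z

-- For the quadrangle, let d₁, d₂, d₃ be the sides of the diagonal triangle D₁D₂D₃. For each
-- vertex Pᵢ the triangle of the other three vertices is perspective from Pᵢ with D₁D₂D₃, so by
-- Desargues the meets of corresponding sides lie on a line pᵢ. Any two of these four axes share a
-- point of some dₖ, which makes p₀p₁p₂p₃ a quadrilateral with diagonal lines d₁, d₂, d₃.
--
-- The dual statement is not obtained by dualising, since only Desargues' theorem and not its
-- converse is assumed. Instead, with Dᵢ the vertices of the diagonal trilateral, the lines from
-- D₁ to p₂·p₃ and p₀·p₁ and from D₂ to p₁·p₃ and p₀·p₂ cut out a quadrangle with D₁ and D₂ as
-- diagonal points, and Desargues (centre p₀·p₃, and p₁·p₂ after relabelling) puts D₃ on both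
-- remaining pairs of opposite sides.

module Submission where

open import Defs
open import Level using (Level)
open import Function using (_∘_)
open import Data.Product using (∃-syntax; _×_; _,_)
open import Relation.Nullary using (¬_)
open import Relation.Binary.PropositionalEquality
  using (_≡_; _≢_; refl; sym; trans; subst; ≢-sym)

module _ {ℓ : Level} (Π : ProjectivePlane ℓ) where
  open ProjectivePlane Π

  private variable
    A B C X Y U V W : Point
    a b c l m : Line

  unique-line : A ≢ B → A I l → B I l → A I m → B I m → l ≡ m
  unique-line A≢B = join-unique _ _ A≢B _ _

  unique-point : l ≢ m → X I l → X I m → Y I l → Y I m → X ≡ Y
  unique-point l≢m = meet-unique _ _ l≢m _ _

  join-transport : A ≢ B → A I l → B I l → A I m → B I m → X I l → X I m
  join-transport A≢B A∈l B∈l A∈m B∈m = subst (_ I_) (unique-line A≢B A∈l B∈l A∈m B∈m)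

  ∉⇒≢-points : ¬ X I l → Y I l → X ≢ Y
  ∉⇒≢-points X∉l Y∈l refl = X∉l Y∈l

  ∉⇒≢-lines : ¬ X I l → X I m → l ≢ m
  ∉⇒≢-lines X∉l X∈m refl = X∉l X∈m

  collinear-swapˡ : Collinear Π A B C → Collinear Π B A C
  collinear-swapˡ (l , A∈l , B∈l , C∈l) = l , B∈l , A∈l , C∈l

  collinear-swapʳ : Collinear Π A B C → Collinear Π A C B
  collinear-swapʳ (l , A∈l , B∈l , C∈l) = l , A∈l , C∈l , B∈l

  concurrent-swapˡ : Concurrent Π a b c → Concurrent Π b a c
  concurrent-swapˡ (X , X∈a , X∈b , X∈c) = X , X∈b , X∈a , X∈c

  concurrent-swapʳ : Concurrent Π a b c → Concurrent Π a c b
  concurrent-swapʳ (X , X∈a , X∈b , X∈c) = X , X∈a , X∈c , X∈b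

  noncollinear⇒∉ : ¬ Collinear Π A B C → B I l → C I l → ¬ A I l
  noncollinear⇒∉ ¬ABC B∈l C∈l A∈l = ¬ABC (_ , A∈l , B∈l , C∈l)

  -- The line l through C covers the case A ≡ C, where no join of A and C exists.
  noncollinear⇒≢ : ¬ Collinear Π A B C → C I l → A ≢ B
  noncollinear⇒≢ {A = A} {C = C} {l = l} ¬AAC C∈l refl
    with join A C (∉⇒≢-points (λ A∈l → ¬AAC (l , A∈l , A∈l , C∈l)) C∈l)
  ... | m , A∈m , C∈m = ¬AAC (m , A∈m , A∈m , C∈m)

  nonconcurrent⇒≢ : ¬ Concurrent Π a b c → X I c → a ≢ b
  nonconcurrent⇒≢ {a = a} {c = c} {X = X} ¬aac X∈c refl
    with meet a c (∉⇒≢-lines (λ X∈a → ¬aac (X , X∈a , X∈a , X∈c)) X∈c)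
  ... | Y , Y∈a , Y∈c = ¬aac (Y , Y∈a , Y∈a , Y∈c)

  sides-meet-at-vertex :
    ¬ Collinear Π A B C → A I l → B I l → A I m → C I m → X I l → X I m → X ≡ A
  sides-meet-at-vertex ¬ABC A∈l B∈l A∈m C∈m X∈l X∈m =
    unique-point (∉⇒≢-lines (λ C∈l → ¬ABC (_ , A∈l , B∈l , C∈l)) C∈m) X∈l X∈m A∈l A∈m

  ∉⇒noncollinear : A ≢ B → A I l → B I l → ¬ C I l → ¬ Collinear Π A B C
  ∉⇒noncollinear A≢B A∈l B∈l C∉l (m , A∈m , B∈m , C∈m) =
    C∉l (join-transport A≢B A∈m B∈m A∈l B∈l C∈m)

  nonconcurrent-of-meets :
    a ≢ b → b ≢ c → X I a → X I b → Y I b → Y I c → X ≢ Y → ¬ Concurrent Π a b c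
  nonconcurrent-of-meets a≢b b≢c X∈a X∈b Y∈b Y∈c X≢Y (Z , Z∈a , Z∈b , Z∈c) =
    X≢Y (trans (unique-point a≢b X∈a X∈b Z∈a Z∈b) (unique-point b≢c Z∈b Z∈c Y∈b Y∈c))

  distinct-transversals : U I l → U I c → V I m → V I c → U ≢ V → W I l → ¬ W I c → l ≢ m
  distinct-transversals U∈l U∈c V∈l V∈c U≢V W∈l W∉c refl =
    W∉c (join-transport U≢V U∈l V∈l U∈c V∈c W∈l)

  meetOfJoins-reverse : ∀ {A B C D} →
    IsMeetOfJoins Π X A B C D → IsMeetOfJoins Π X B A D C
  meetOfJoins-reverse (l , m , A∈l , B∈l , C∈m , D∈m , X∈l , X∈m) =
    l , m , B∈l , A∈l , D∈m , C∈m , X∈l , X∈m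

  meetOfJoins-swap : ∀ {A B C D} →
    IsMeetOfJoins Π X A B C D → IsMeetOfJoins Π X C D A B
  meetOfJoins-swap (l , m , A∈l , B∈l , C∈m , D∈m , X∈l , X∈m) =
    m , l , C∈m , D∈m , A∈l , B∈l , X∈m , X∈l

  -- The relabellings (P₀P₁)(P₂P₃) and (P₀P₂)(P₁P₃) fix every diagonal point.
  quadrangle-flip₁ : ∀ {P₀ P₁ P₂ P₃} →
    IsQuadrangle Π P₀ P₁ P₂ P₃ → IsQuadrangle Π P₁ P₀ P₃ P₂
  quadrangle-flip₁ (¬P₀P₁P₂ , ¬P₀P₁P₃ , ¬P₀P₂P₃ , ¬P₁P₂P₃) =
    ¬P₀P₁P₃ ∘ collinear-swapˡ , ¬P₀P₁P₂ ∘ collinear-swapˡ ,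
    ¬P₁P₂P₃ ∘ collinear-swapʳ , ¬P₀P₂P₃ ∘ collinear-swapʳ

  quadrangle-flip₂ : ∀ {P₀ P₁ P₂ P₃} →
    IsQuadrangle Π P₀ P₁ P₂ P₃ → IsQuadrangle Π P₂ P₃ P₀ P₁
  quadrangle-flip₂ (¬P₀P₁P₂ , ¬P₀P₁P₃ , ¬P₀P₂P₃ , ¬P₁P₂P₃) =
    ¬P₀P₂P₃ ∘ collinear-swapˡ ∘ collinear-swapʳ , ¬P₁P₂P₃ ∘ collinear-swapˡ ∘ collinear-swapʳ ,
    ¬P₀P₁P₂ ∘ collinear-swapʳ ∘ collinear-swapˡ , ¬P₀P₁P₃ ∘ collinear-swapʳ ∘ collinear-swapˡ

  diagonalPoints-flip₁ : ∀ {P₀ P₁ P₂ P₃ D₁ D₂ D₃} →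
    AreDiagonalPoints Π P₀ P₁ P₂ P₃ D₁ D₂ D₃ → AreDiagonalPoints Π P₁ P₀ P₃ P₂ D₁ D₂ D₃
  diagonalPoints-flip₁ (δ₁ , δ₂ , δ₃) =
    meetOfJoins-reverse δ₁ , meetOfJoins-reverse (meetOfJoins-swap δ₂) , meetOfJoins-swap δ₃

  diagonalPoints-flip₂ : ∀ {P₀ P₁ P₂ P₃ D₁ D₂ D₃} →
    AreDiagonalPoints Π P₀ P₁ P₂ P₃ D₁ D₂ D₃ → AreDiagonalPoints Π P₂ P₃ P₀ P₁ D₁ D₂ D₃
  diagonalPoints-flip₂ (δ₁ , δ₂ , δ₃) =
    meetOfJoins-swap δ₁ , meetOfJoins-reverse δ₂ , meetOfJoins-reverse (meetOfJoins-swap δ₃)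

  quadrilateral-of-transversals :
    ∀ {d₁ d₂ d₃ E₁ E₁′ E₂ E₂′ E₃ E₃′} →
    E₁ I d₁ → E₁′ I d₁ → E₂ I d₂ → E₂′ I d₂ → E₃ I d₃ → E₃′ I d₃ →
    E₁ ≢ E₁′ → E₂ ≢ E₂′ →
    ¬ E₁ I d₂ → ¬ E₂ I d₁ → ¬ E₃ I d₁ → ¬ E₃ I d₂ →
    Collinear Π E₁′ E₂′ E₃′ → Collinear Π E₁′ E₂ E₃ →
    Collinear Π E₁ E₂′ E₃ → Collinear Π E₁ E₂ E₃′ →
    ∃[ p₀ ] ∃[ p₁ ] ∃[ p₂ ] ∃[ p₃ ]
      (IsQuadrilateral Π p₀ p₁ p₂ p₃ × AreDiagonalLines Π p₀ p₁ p₂ p₃ d₁ d₂ d₃)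
  quadrilateral-of-transversals
      E₁∈d₁ E₁′∈d₁ E₂∈d₂ E₂′∈d₂ E₃∈d₃ E₃′∈d₃ E₁≢E₁′ E₂≢E₂′ E₁∉d₂ E₂∉d₁ E₃∉d₁ E₃∉d₂
      (p₀ , E₁′∈p₀ , E₂′∈p₀ , E₃′∈p₀) (p₁ , E₁′∈p₁ , E₂∈p₁ , E₃∈p₁)
      (p₂ , E₁∈p₂ , E₂′∈p₂ , E₃∈p₂) (p₃ , E₁∈p₃ , E₂∈p₃ , E₃′∈p₃) =
    p₀ , p₁ , p₂ , p₃ ,
    ( nonconcurrent-of-meets p₀≢p₁ p₁≢p₂ E₁′∈p₀ E₁′∈p₁ E₃∈p₁ E₃∈p₂
        (≢-sym (∉⇒≢-points E₃∉d₁ E₁′∈d₁))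
    , nonconcurrent-of-meets p₀≢p₁ p₁≢p₃ E₁′∈p₀ E₁′∈p₁ E₂∈p₁ E₂∈p₃
        (≢-sym (∉⇒≢-points E₂∉d₁ E₁′∈d₁))
    , nonconcurrent-of-meets p₀≢p₂ p₂≢p₃ E₂′∈p₀ E₂′∈p₂ E₁∈p₂ E₁∈p₃
        (≢-sym (∉⇒≢-points E₁∉d₂ E₂′∈d₂))
    , nonconcurrent-of-meets p₁≢p₂ p₂≢p₃ E₃∈p₁ E₃∈p₂ E₁∈p₂ E₁∈p₃
        (∉⇒≢-points E₃∉d₁ E₁∈d₁) ) ,
    ( (_ , _ , E₁′∈p₀ , E₁′∈p₁ , E₁∈p₂ , E₁∈p₃ , E₁′∈d₁ , E₁∈d₁)
    , (_ , _ , E₂′∈p₀ , E₂′∈p₂ , E₂∈p₃ , E₂∈p₁ , E₂′∈d₂ , E₂∈d₂)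
    , (_ , _ , E₃′∈p₀ , E₃′∈p₃ , E₃∈p₁ , E₃∈p₂ , E₃′∈d₃ , E₃∈d₃) )
    where
    p₀≢p₁ : p₀ ≢ p₁
    p₀≢p₁ = ≢-sym (distinct-transversals E₂∈p₁ E₂∈d₂ E₂′∈p₀ E₂′∈d₂ E₂≢E₂′ E₃∈p₁ E₃∉d₂)
    p₀≢p₂ : p₀ ≢ p₂
    p₀≢p₂ = ≢-sym (distinct-transversals E₁∈p₂ E₁∈d₁ E₁′∈p₀ E₁′∈d₁ E₁≢E₁′ E₃∈p₂ E₃∉d₁)
    p₁≢p₂ : p₁ ≢ p₂
    p₁≢p₂ = distinct-transversals E₁′∈p₁ E₁′∈d₁ E₁∈p₂ E₁∈d₁ (≢-sym E₁≢E₁′) E₃∈p₁ E₃∉d₁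
    p₁≢p₃ : p₁ ≢ p₃
    p₁≢p₃ = distinct-transversals E₁′∈p₁ E₁′∈d₁ E₁∈p₃ E₁∈d₁ (≢-sym E₁≢E₁′) E₃∈p₁ E₃∉d₁
    p₂≢p₃ : p₂ ≢ p₃
    p₂≢p₃ = distinct-transversals E₂′∈p₂ E₂′∈d₂ E₂∈p₃ E₂∈d₂ (≢-sym E₂≢E₂′) E₁∈p₂ E₁∉d₂

  quadrangle-of-pencils :
    ∀ {D₁ D₂ a₀₁ a₂₃ a₀₂ a₁₃} →
    D₁ I a₀₁ → D₁ I a₂₃ → D₂ I a₀₂ → D₂ I a₁₃ → a₀₁ ≢ a₂₃ → a₀₂ ≢ a₁₃ →
    ¬ D₂ I a₀₁ → ¬ D₂ I a₂₃ → ¬ D₁ I a₀₂ → ¬ D₁ I a₁₃ →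
    ∃[ P₀ ] ∃[ P₁ ] ∃[ P₂ ] ∃[ P₃ ]
      ((P₀ I a₀₁ × P₀ I a₀₂) × (P₁ I a₀₁ × P₁ I a₁₃) ×
       (P₂ I a₀₂ × P₂ I a₂₃) × (P₃ I a₁₃ × P₃ I a₂₃) × IsQuadrangle Π P₀ P₁ P₂ P₃)
  quadrangle-of-pencils {D₁} {D₂} {a₀₁} {a₂₃} {a₀₂} {a₁₃}
      D₁∈a₀₁ D₁∈a₂₃ D₂∈a₀₂ D₂∈a₁₃ a₀₁≢a₂₃ a₀₂≢a₁₃ D₂∉a₀₁ D₂∉a₂₃ D₁∉a₀₂ D₁∉a₁₃
    with meet a₀₁ a₀₂ (∉⇒≢-lines D₂∉a₀₁ D₂∈a₀₂) | meet a₀₁ a₁₃ (∉⇒≢-lines D₂∉a₀₁ D₂∈a₁₃)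
       | meet a₀₂ a₂₃ (∉⇒≢-lines D₁∉a₀₂ D₁∈a₂₃) | meet a₁₃ a₂₃ (∉⇒≢-lines D₁∉a₁₃ D₁∈a₂₃)
  ... | P₀ , P₀∈a₀₁ , P₀∈a₀₂ | P₁ , P₁∈a₀₁ , P₁∈a₁₃
      | P₂ , P₂∈a₀₂ , P₂∈a₂₃ | P₃ , P₃∈a₁₃ , P₃∈a₂₃ =
    P₀ , P₁ , P₂ , P₃ ,
    (P₀∈a₀₁ , P₀∈a₀₂) , (P₁∈a₀₁ , P₁∈a₁₃) , (P₂∈a₀₂ , P₂∈a₂₃) , (P₃∈a₁₃ , P₃∈a₂₃) ,
    ( ∉⇒noncollinear P₀≢P₁ P₀∈a₀₁ P₁∈a₀₁ P₂∉a₀₁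
    , ∉⇒noncollinear P₀≢P₁ P₀∈a₀₁ P₁∈a₀₁ P₃∉a₀₁
    , ∉⇒noncollinear P₀≢P₂ P₀∈a₀₂ P₂∈a₀₂ P₃∉a₀₂
    , ∉⇒noncollinear P₂≢P₃ P₂∈a₂₃ P₃∈a₂₃ P₁∉a₂₃ ∘ collinear-swapʳ ∘ collinear-swapˡ )
    where
    at-D₁ : X I a₀₁ → X I a₂₃ → X ≡ D₁
    at-D₁ X∈a₀₁ X∈a₂₃ = unique-point a₀₁≢a₂₃ X∈a₀₁ X∈a₂₃ D₁∈a₀₁ D₁∈a₂₃
    at-D₂ : X I a₀₂ → X I a₁₃ → X ≡ D₂
    at-D₂ X∈a₀₂ X∈a₁₃ = unique-point a₀₂≢a₁₃ X∈a₀₂ X∈a₁₃ D₂∈a₀₂ D₂∈a₁₃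
    P₀∉a₁₃ : ¬ P₀ I a₁₃
    P₀∉a₁₃ P₀∈a₁₃ = D₂∉a₀₁ (subst (_I a₀₁) (at-D₂ P₀∈a₀₂ P₀∈a₁₃) P₀∈a₀₁)
    P₀∉a₂₃ : ¬ P₀ I a₂₃
    P₀∉a₂₃ P₀∈a₂₃ = D₁∉a₀₂ (subst (_I a₀₂) (at-D₁ P₀∈a₀₁ P₀∈a₂₃) P₀∈a₀₂)
    P₁∉a₂₃ : ¬ P₁ I a₂₃
    P₁∉a₂₃ P₁∈a₂₃ = D₁∉a₁₃ (subst (_I a₁₃) (at-D₁ P₁∈a₀₁ P₁∈a₂₃) P₁∈a₁₃)
    P₂∉a₀₁ : ¬ P₂ I a₀₁
    P₂∉a₀₁ P₂∈a₀₁ = D₁∉a₀₂ (subst (_I a₀₂) (at-D₁ P₂∈a₀₁ P₂∈a₂₃) P₂∈a₀₂)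
    P₂∉a₁₃ : ¬ P₂ I a₁₃
    P₂∉a₁₃ P₂∈a₁₃ = D₂∉a₂₃ (subst (_I a₂₃) (at-D₂ P₂∈a₀₂ P₂∈a₁₃) P₂∈a₂₃)
    P₃∉a₀₁ : ¬ P₃ I a₀₁
    P₃∉a₀₁ P₃∈a₀₁ = D₁∉a₁₃ (subst (_I a₁₃) (at-D₁ P₃∈a₀₁ P₃∈a₂₃) P₃∈a₁₃)
    P₃∉a₀₂ : ¬ P₃ I a₀₂
    P₃∉a₀₂ P₃∈a₀₂ = D₂∉a₂₃ (subst (_I a₂₃) (at-D₂ P₃∈a₀₂ P₃∈a₁₃) P₃∈a₂₃)
    P₀≢P₁ : P₀ ≢ P₁
    P₀≢P₁ = ∉⇒≢-points P₀∉a₁₃ P₁∈a₁₃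
    P₀≢P₂ : P₀ ≢ P₂
    P₀≢P₂ = ∉⇒≢-points P₀∉a₂₃ P₂∈a₂₃
    P₂≢P₃ : P₂ ≢ P₃
    P₂≢P₃ = ∉⇒≢-points P₂∉a₁₃ P₃∈a₁₃

  IsJoinOfMeetsAt : Line → Line → Line → Line → Line → Point → Point → Set ℓ
  IsJoinOfMeetsAt d a b c e X Y = X I a × X I b × Y I c × Y I e × X I d × Y I d

  module _ (desargues : Desarguesian Π) where

    -- P₁P₂P₃ and D₁D₂D₃ are perspective from P₀.
    diagonal-triangle-axis :
      ∀ {P₀ P₁ P₂ P₃ D₁ D₂ D₃ X Y Z} →
      IsQuadrangle Π P₀ P₁ P₂ P₃ → AreDiagonalPoints Π P₀ P₁ P₂ P₃ D₁ D₂ D₃ →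
      ¬ Collinear Π D₁ D₂ D₃ →
      IsMeetOfJoins Π X P₂ P₃ D₂ D₃ → IsMeetOfJoins Π Y P₃ P₁ D₃ D₁ →
      IsMeetOfJoins Π Z P₁ P₂ D₁ D₂ → Collinear Π X Y Z
    diagonal-triangle-axis {P₀} {P₁} {P₂} {P₃} {D₁} {D₂} {D₃}
        (¬P₀P₁P₂ , ¬P₀P₁P₃ , ¬P₀P₂P₃ , ¬P₁P₂P₃)
        ((s₀₁ , s₂₃ , P₀∈s₀₁ , P₁∈s₀₁ , P₂∈s₂₃ , P₃∈s₂₃ , D₁∈s₀₁ , D₁∈s₂₃) ,
         (s₀₂ , s₃₁ , P₀∈s₀₂ , P₂∈s₀₂ , P₃∈s₃₁ , P₁∈s₃₁ , D₂∈s₀₂ , D₂∈s₃₁) ,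
         (s₀₃ , s₁₂ , P₀∈s₀₃ , P₃∈s₀₃ , P₁∈s₁₂ , P₂∈s₁₂ , D₃∈s₀₃ , D₃∈s₁₂))
        ¬D₁D₂D₃ X Y Z =
      desargues P₀ P₂ P₃ P₁ D₂ D₃ D₁ ¬P₂P₃P₁ (¬D₁D₂D₃ ∘ collinear-swapˡ ∘ collinear-swapʳ)
        P₂≢D₂ P₃≢D₃ P₁≢D₁
        (s₀₂ , P₀∈s₀₂ , P₂∈s₀₂ , D₂∈s₀₂) (s₀₃ , P₀∈s₀₃ , P₃∈s₀₃ , D₃∈s₀₃)
        (s₀₁ , P₀∈s₀₁ , P₁∈s₀₁ , D₁∈s₀₁)
        ¬P₂P₃D₂D₃ ¬P₃P₁D₃D₁ ¬P₁P₂D₁D₂ _ _ _ X Y Z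
      where
      ¬P₂P₃P₁ : ¬ Collinear Π P₂ P₃ P₁
      ¬P₂P₃P₁ = ¬P₁P₂P₃ ∘ collinear-swapˡ ∘ collinear-swapʳ
      P₁≢D₁ : P₁ ≢ D₁
      P₁≢D₁ = ∉⇒≢-points (noncollinear⇒∉ ¬P₁P₂P₃ P₂∈s₂₃ P₃∈s₂₃) D₁∈s₂₃
      P₂≢D₂ : P₂ ≢ D₂
      P₂≢D₂ = ∉⇒≢-points (noncollinear⇒∉ ¬P₂P₃P₁ P₃∈s₃₁ P₁∈s₃₁) D₂∈s₃₁
      P₃≢D₃ : P₃ ≢ D₃
      P₃≢D₃ = ∉⇒≢-points (noncollinear⇒∉ (¬P₂P₃P₁ ∘ collinear-swapˡ) P₂∈s₁₂ P₁∈s₁₂) D₃∈s₁₂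
      ¬P₂P₃D₂D₃ : ¬ Collinear4 Π P₂ P₃ D₂ D₃
      ¬P₂P₃D₂D₃ (k , P₂∈k , P₃∈k , D₂∈k , _) =
        ¬P₀P₂P₃ (k , join-transport P₂≢D₂ P₂∈s₀₂ D₂∈s₀₂ P₂∈k D₂∈k P₀∈s₀₂ , P₂∈k , P₃∈k)
      ¬P₃P₁D₃D₁ : ¬ Collinear4 Π P₃ P₁ D₃ D₁
      ¬P₃P₁D₃D₁ (k , P₃∈k , P₁∈k , D₃∈k , _) =
        ¬P₀P₁P₃ (k , join-transport P₃≢D₃ P₃∈s₀₃ D₃∈s₀₃ P₃∈k D₃∈k P₀∈s₀₃ , P₁∈k , P₃∈k)
      ¬P₁P₂D₁D₂ : ¬ Collinear4 Π P₁ P₂ D₁ D₂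
      ¬P₁P₂D₁D₂ (k , P₁∈k , P₂∈k , D₁∈k , _) =
        ¬P₀P₁P₂ (k , join-transport P₁≢D₁ P₁∈s₀₁ D₁∈s₀₁ P₁∈k D₁∈k P₀∈s₀₁ , P₁∈k , P₂∈k)

    -- V₂₃D₁V₀₁ and V₁₃D₂V₀₂ are perspective from V₀₃.
    diagonal-trilateral-axis :
      ∀ {p₀ p₁ p₂ p₃ d₁ d₂ d₃ V₀₁ V₂₃ V₀₂ V₁₃ V₀₃ V₁₂ D₁ D₂ D₃ X Y} →
      ¬ Concurrent Π p₀ p₁ p₂ → ¬ Concurrent Π p₁ p₂ p₃ → ¬ Concurrent Π d₁ d₂ d₃ →
      IsJoinOfMeetsAt d₁ p₀ p₁ p₂ p₃ V₀₁ V₂₃ → IsJoinOfMeetsAt d₂ p₀ p₂ p₃ p₁ V₀₂ V₁₃ →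
      IsJoinOfMeetsAt d₃ p₀ p₃ p₁ p₂ V₀₃ V₁₂ →
      D₁ I d₂ → D₁ I d₃ → D₂ I d₃ → D₂ I d₁ → D₃ I d₁ → D₃ I d₂ →
      IsMeetOfJoins Π X V₂₃ D₁ V₁₃ D₂ → IsMeetOfJoins Π Y D₁ V₀₁ D₂ V₀₂ → Collinear Π X Y D₃
    diagonal-trilateral-axis {p₀ = p₀} {p₃ = p₃} {d₁ = d₁} {d₂ = d₂} {d₃ = d₃} {V₀₁ = V₀₁} {V₂₃ = V₂₃}
        {V₀₂ = V₀₂} {V₁₃ = V₁₃} {V₀₃ = V₀₃} {V₁₂ = V₁₂} {D₁ = D₁} {D₂ = D₂} ¬p₀p₁p₂ ¬p₁p₂p₃ ¬d₁d₂d₃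
        (V₀₁∈p₀ , V₀₁∈p₁ , V₂₃∈p₂ , V₂₃∈p₃ , V₀₁∈d₁ , V₂₃∈d₁)
        (V₀₂∈p₀ , V₀₂∈p₂ , V₁₃∈p₃ , V₁₃∈p₁ , V₀₂∈d₂ , V₁₃∈d₂)
        (V₀₃∈p₀ , V₀₃∈p₃ , V₁₂∈p₁ , V₁₂∈p₂ , V₀₃∈d₃ , V₁₂∈d₃)
        D₁∈d₂ D₁∈d₃ D₂∈d₃ D₂∈d₁ D₃∈d₁ D₃∈d₂ X Y =
      desargues V₀₃ V₂₃ D₁ V₀₁ V₁₃ D₂ V₀₂ ¬V₂₃D₁V₀₁ ¬V₁₃D₂V₀₂ V₂₃≢V₁₃ D₁≢D₂ V₀₁≢V₀₂
        (p₃ , V₀₃∈p₃ , V₂₃∈p₃ , V₁₃∈p₃) (d₃ , V₀₃∈d₃ , D₁∈d₃ , D₂∈d₃)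
        (p₀ , V₀₃∈p₀ , V₀₁∈p₀ , V₀₂∈p₀)
        ¬V₂₃D₁V₁₃D₂ ¬D₁V₀₁D₂V₀₂ ¬V₀₁V₂₃V₀₂V₁₃ _ _ _ X Y
        (d₁ , d₂ , V₀₁∈d₁ , V₂₃∈d₁ , V₀₂∈d₂ , V₁₃∈d₂ , D₃∈d₁ , D₃∈d₂)
      where
      V₀₁≢V₂₃ : V₀₁ ≢ V₂₃
      V₀₁≢V₂₃ = ∉⇒≢-points (λ V₀₁∈p₂ → ¬p₀p₁p₂ (V₀₁ , V₀₁∈p₀ , V₀₁∈p₁ , V₀₁∈p₂)) V₂₃∈p₂
      V₀₂≢V₁₃ : V₀₂ ≢ V₁₃
      V₀₂≢V₁₃ = ∉⇒≢-points (λ V₀₂∈p₁ → ¬p₀p₁p₂ (V₀₂ , V₀₂∈p₀ , V₀₂∈p₁ , V₀₂∈p₂)) V₁₃∈p₁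
      V₀₁≢V₀₂ : V₀₁ ≢ V₀₂
      V₀₁≢V₀₂ = ∉⇒≢-points (λ V₀₁∈p₂ → ¬p₀p₁p₂ (V₀₁ , V₀₁∈p₀ , V₀₁∈p₁ , V₀₁∈p₂)) V₀₂∈p₂
      V₂₃≢V₁₃ : V₂₃ ≢ V₁₃
      V₂₃≢V₁₃ = ∉⇒≢-points (λ V₂₃∈p₁ → ¬p₁p₂p₃ (V₂₃ , V₂₃∈p₁ , V₂₃∈p₂ , V₂₃∈p₃)) V₁₃∈p₁
      D₁≢D₂ : D₁ ≢ D₂
      D₁≢D₂ = ∉⇒≢-points (λ D₁∈d₁ → ¬d₁d₂d₃ (D₁ , D₁∈d₁ , D₁∈d₂ , D₁∈d₃)) D₂∈d₁
      ¬V₂₃D₁V₀₁ : ¬ Collinear Π V₂₃ D₁ V₀₁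
      ¬V₂₃D₁V₀₁ (k , V₂₃∈k , D₁∈k , V₀₁∈k) =
        ¬d₁d₂d₃ (D₁ , join-transport V₀₁≢V₂₃ V₀₁∈k V₂₃∈k V₀₁∈d₁ V₂₃∈d₁ D₁∈k , D₁∈d₂ , D₁∈d₃)
      ¬V₁₃D₂V₀₂ : ¬ Collinear Π V₁₃ D₂ V₀₂
      ¬V₁₃D₂V₀₂ (k , V₁₃∈k , D₂∈k , V₀₂∈k) =
        ¬d₁d₂d₃ (D₂ , D₂∈d₁ , join-transport V₀₂≢V₁₃ V₀₂∈k V₁₃∈k V₀₂∈d₂ V₁₃∈d₂ D₂∈k , D₂∈d₃)
      ¬V₂₃D₁V₁₃D₂ : ¬ Collinear4 Π V₂₃ D₁ V₁₃ D₂
      ¬V₂₃D₁V₁₃D₂ (k , V₂₃∈k , D₁∈k , V₁₃∈k , D₂∈k) =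
        ¬p₁p₂p₃ (V₁₂ , V₁₂∈p₁ , V₁₂∈p₂ , join-transport V₂₃≢V₁₃ V₂₃∈k V₁₃∈k V₂₃∈p₃ V₁₃∈p₃
          (join-transport D₁≢D₂ D₁∈d₃ D₂∈d₃ D₁∈k D₂∈k V₁₂∈d₃))
      ¬D₁V₀₁D₂V₀₂ : ¬ Collinear4 Π D₁ V₀₁ D₂ V₀₂
      ¬D₁V₀₁D₂V₀₂ (k , D₁∈k , V₀₁∈k , D₂∈k , V₀₂∈k) =
        ¬p₀p₁p₂ (V₁₂ , join-transport V₀₁≢V₀₂ V₀₁∈k V₀₂∈k V₀₁∈p₀ V₀₂∈p₀
          (join-transport D₁≢D₂ D₁∈d₃ D₂∈d₃ D₁∈k D₂∈k V₁₂∈d₃) , V₁₂∈p₁ , V₁₂∈p₂)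
      ¬V₀₁V₂₃V₀₂V₁₃ : ¬ Collinear4 Π V₀₁ V₂₃ V₀₂ V₁₃
      ¬V₀₁V₂₃V₀₂V₁₃ (k , V₀₁∈k , V₂₃∈k , V₀₂∈k , V₁₃∈k) =
        ¬d₁d₂d₃ (D₂ , D₂∈d₁ , join-transport V₀₂≢V₁₃ V₀₂∈k V₁₃∈k V₀₂∈d₂ V₁₃∈d₂
          (join-transport V₀₁≢V₂₃ V₀₁∈d₁ V₂₃∈d₁ V₀₁∈k V₂₃∈k D₂∈d₁) , D₂∈d₃)

    quadrilateral-of-quadrangle :
      (P₀ P₁ P₂ P₃ D₁ D₂ D₃ : Point) →
      IsQuadrangle Π P₀ P₁ P₂ P₃ → AreDiagonalPoints Π P₀ P₁ P₂ P₃ D₁ D₂ D₃ →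
      ¬ Collinear Π D₁ D₂ D₃ →
      ∃[ p₀ ] ∃[ p₁ ] ∃[ p₂ ] ∃[ p₃ ] ∃[ d₁ ] ∃[ d₂ ] ∃[ d₃ ]
        (IsQuadrilateral Π p₀ p₁ p₂ p₃ ×
         AreDiagonalLines Π p₀ p₁ p₂ p₃ d₁ d₂ d₃ ×
         DiagonalMatch Π D₁ D₂ D₃ d₁ d₂ d₃)
    quadrilateral-of-quadrangle P₀ P₁ P₂ P₃ D₁ D₂ D₃
        quad@(¬P₀P₁P₂ , ¬P₀P₁P₃ , ¬P₀P₂P₃ , _)
        diag@((s₀₁ , s₂₃ , P₀∈s₀₁ , P₁∈s₀₁ , P₂∈s₂₃ , P₃∈s₂₃ , D₁∈s₀₁ , D₁∈s₂₃) ,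
              (s₀₂ , s₃₁ , P₀∈s₀₂ , P₂∈s₀₂ , P₃∈s₃₁ , P₁∈s₃₁ , D₂∈s₀₂ , D₂∈s₃₁) ,
              (s₀₃ , s₁₂ , P₀∈s₀₃ , P₃∈s₀₃ , P₁∈s₁₂ , P₂∈s₁₂ , D₃∈s₀₃ , D₃∈s₁₂))
        ¬D
      with join D₂ D₃ (noncollinear⇒≢ (¬D ∘ collinear-swapˡ ∘ collinear-swapʳ) D₁∈s₀₁)
         | join D₃ D₁ (noncollinear⇒≢ (¬D ∘ collinear-swapʳ ∘ collinear-swapˡ) D₂∈s₀₂)
         | join D₁ D₂ (noncollinear⇒≢ ¬D D₃∈s₀₃)
    ... | d₁ , D₂∈d₁ , D₃∈d₁ | d₂ , D₃∈d₂ , D₁∈d₂ | d₃ , D₁∈d₃ , D₂∈d₃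
      with meet s₀₁ d₁ (λ { refl → ¬D (s₀₁ , D₁∈s₀₁ , D₂∈d₁ , D₃∈d₁) })
         | meet s₂₃ d₁ (λ { refl → ¬D (s₂₃ , D₁∈s₂₃ , D₂∈d₁ , D₃∈d₁) })
         | meet s₀₂ d₂ (λ { refl → ¬D (s₀₂ , D₁∈d₂ , D₂∈s₀₂ , D₃∈d₂) })
         | meet s₃₁ d₂ (λ { refl → ¬D (s₃₁ , D₁∈d₂ , D₂∈s₃₁ , D₃∈d₂) })
         | meet s₀₃ d₃ (λ { refl → ¬D (s₀₃ , D₁∈d₃ , D₂∈d₃ , D₃∈s₀₃) })
         | meet s₁₂ d₃ (λ { refl → ¬D (s₁₂ , D₁∈d₃ , D₂∈d₃ , D₃∈s₁₂) })
    ... | E₁ , E₁∈s₀₁ , E₁∈d₁ | E₁′ , E₁′∈s₂₃ , E₁′∈d₁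
        | E₂ , E₂∈s₀₂ , E₂∈d₂ | E₂′ , E₂′∈s₃₁ , E₂′∈d₂
        | E₃ , E₃∈s₀₃ , E₃∈d₃ | E₃′ , E₃′∈s₁₂ , E₃′∈d₃ =
      let p₀ , p₁ , p₂ , p₃ , quadrilateral , diagonals =
            quadrilateral-of-transversals E₁∈d₁ E₁′∈d₁ E₂∈d₂ E₂′∈d₂ E₃∈d₃ E₃′∈d₃
              E₁≢E₁′ E₂≢E₂′ E₁∉d₂ E₂∉d₁ E₃∉d₁ E₃∉d₂
              (diagonal-triangle-axis quad diag ¬D
                (on-d₁ P₂∈s₂₃ P₃∈s₂₃ E₁′∈s₂₃ E₁′∈d₁) (on-d₂ P₃∈s₃₁ P₁∈s₃₁ E₂′∈s₃₁ E₂′∈d₂)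
                (on-d₃ P₁∈s₁₂ P₂∈s₁₂ E₃′∈s₁₂ E₃′∈d₃))
              (diagonal-triangle-axis (quadrangle-flip₁ quad) (diagonalPoints-flip₁ diag) ¬D
                (on-d₁ P₃∈s₂₃ P₂∈s₂₃ E₁′∈s₂₃ E₁′∈d₁) (on-d₂ P₂∈s₀₂ P₀∈s₀₂ E₂∈s₀₂ E₂∈d₂)
                (on-d₃ P₀∈s₀₃ P₃∈s₀₃ E₃∈s₀₃ E₃∈d₃))
              (diagonal-triangle-axis (quadrangle-flip₂ quad) (diagonalPoints-flip₂ diag) ¬D
                (on-d₁ P₀∈s₀₁ P₁∈s₀₁ E₁∈s₀₁ E₁∈d₁) (on-d₂ P₁∈s₃₁ P₃∈s₃₁ E₂′∈s₃₁ E₂′∈d₂)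
                (on-d₃ P₃∈s₀₃ P₀∈s₀₃ E₃∈s₀₃ E₃∈d₃))
              (diagonal-triangle-axis (quadrangle-flip₁ (quadrangle-flip₂ quad))
                (diagonalPoints-flip₁ (diagonalPoints-flip₂ diag)) ¬D
                (on-d₁ P₁∈s₀₁ P₀∈s₀₁ E₁∈s₀₁ E₁∈d₁) (on-d₂ P₀∈s₀₂ P₂∈s₀₂ E₂∈s₀₂ E₂∈d₂)
                (on-d₃ P₂∈s₁₂ P₁∈s₁₂ E₃′∈s₁₂ E₃′∈d₃))
      in p₀ , p₁ , p₂ , p₃ , d₁ , d₂ , d₃ , quadrilateral , diagonals ,
         (D₂∈d₁ , D₃∈d₁) , (D₃∈d₂ , D₁∈d₂) , (D₁∈d₃ , D₂∈d₃)
      where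
      on-d₁ : ∀ {Q R k} → Q I k → R I k → X I k → X I d₁ → IsMeetOfJoins Π X Q R D₂ D₃
      on-d₁ Q∈k R∈k X∈k X∈d₁ = _ , d₁ , Q∈k , R∈k , D₂∈d₁ , D₃∈d₁ , X∈k , X∈d₁
      on-d₂ : ∀ {Q R k} → Q I k → R I k → X I k → X I d₂ → IsMeetOfJoins Π X Q R D₃ D₁
      on-d₂ Q∈k R∈k X∈k X∈d₂ = _ , d₂ , Q∈k , R∈k , D₃∈d₂ , D₁∈d₂ , X∈k , X∈d₂
      on-d₃ : ∀ {Q R k} → Q I k → R I k → X I k → X I d₃ → IsMeetOfJoins Π X Q R D₁ D₂
      on-d₃ Q∈k R∈k X∈k X∈d₃ = _ , d₃ , Q∈k , R∈k , D₁∈d₃ , D₂∈d₃ , X∈k , X∈d₃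
      D₁∉d₁ : ¬ D₁ I d₁
      D₁∉d₁ = noncollinear⇒∉ ¬D D₂∈d₁ D₃∈d₁
      D₂∉d₂ : ¬ D₂ I d₂
      D₂∉d₂ = noncollinear⇒∉ (¬D ∘ collinear-swapˡ) D₁∈d₂ D₃∈d₂
      d₁≢d₂ : d₁ ≢ d₂
      d₁≢d₂ = ∉⇒≢-lines D₁∉d₁ D₁∈d₂
      d₁≢d₃ : d₁ ≢ d₃
      d₁≢d₃ = ∉⇒≢-lines D₁∉d₁ D₁∈d₃
      d₂≢d₃ : d₂ ≢ d₃
      d₂≢d₃ = ∉⇒≢-lines D₂∉d₂ D₂∈d₃
      P₀∉s₂₃ : ¬ P₀ I s₂₃
      P₀∉s₂₃ = noncollinear⇒∉ ¬P₀P₂P₃ P₂∈s₂₃ P₃∈s₂₃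
      P₀∉s₃₁ : ¬ P₀ I s₃₁
      P₀∉s₃₁ = noncollinear⇒∉ ¬P₀P₁P₃ P₁∈s₃₁ P₃∈s₃₁
      P₀≢D₁ : P₀ ≢ D₁
      P₀≢D₁ = ∉⇒≢-points P₀∉s₂₃ D₁∈s₂₃
      P₀≢D₂ : P₀ ≢ D₂
      P₀≢D₂ = ∉⇒≢-points P₀∉s₃₁ D₂∈s₃₁
      P₀≢D₃ : P₀ ≢ D₃
      P₀≢D₃ = ∉⇒≢-points (noncollinear⇒∉ ¬P₀P₁P₂ P₁∈s₁₂ P₂∈s₁₂) D₃∈s₁₂
      E₁∉d₂ : ¬ E₁ I d₂
      E₁∉d₂ E₁∈d₂ = P₀≢D₃ (sym (sides-meet-at-vertex ¬P₀P₁P₃ P₀∈s₀₁ P₁∈s₀₁ P₀∈s₀₃ P₃∈s₀₃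
        (subst (_I s₀₁) (unique-point d₁≢d₂ E₁∈d₁ E₁∈d₂ D₃∈d₁ D₃∈d₂) E₁∈s₀₁) D₃∈s₀₃))
      E₂∉d₁ : ¬ E₂ I d₁
      E₂∉d₁ E₂∈d₁ = P₀≢D₃ (sym (sides-meet-at-vertex ¬P₀P₂P₃ P₀∈s₀₂ P₂∈s₀₂ P₀∈s₀₃ P₃∈s₀₃
        (subst (_I s₀₂) (unique-point d₁≢d₂ E₂∈d₁ E₂∈d₂ D₃∈d₁ D₃∈d₂) E₂∈s₀₂) D₃∈s₀₃))
      E₃∉d₁ : ¬ E₃ I d₁
      E₃∉d₁ E₃∈d₁ = P₀≢D₂ (sym (sides-meet-at-vertex (¬P₀P₂P₃ ∘ collinear-swapʳ)
        P₀∈s₀₃ P₃∈s₀₃ P₀∈s₀₂ P₂∈s₀₂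
        (subst (_I s₀₃) (unique-point d₁≢d₃ E₃∈d₁ E₃∈d₃ D₂∈d₁ D₂∈d₃) E₃∈s₀₃) D₂∈s₀₂))
      E₃∉d₂ : ¬ E₃ I d₂
      E₃∉d₂ E₃∈d₂ = P₀≢D₁ (sym (sides-meet-at-vertex (¬P₀P₁P₃ ∘ collinear-swapʳ)
        P₀∈s₀₃ P₃∈s₀₃ P₀∈s₀₁ P₁∈s₀₁
        (subst (_I s₀₃) (unique-point d₂≢d₃ E₃∈d₂ E₃∈d₃ D₁∈d₂ D₁∈d₃) E₃∈s₀₃) D₁∈s₀₁))
      E₁≢E₁′ : E₁ ≢ E₁′
      E₁≢E₁′ = ∉⇒≢-points (λ E₁∈s₂₃ → D₁∉d₁ (subst (_I d₁)
        (unique-point (∉⇒≢-lines P₀∉s₂₃ P₀∈s₀₁) E₁∈s₂₃ E₁∈s₀₁ D₁∈s₂₃ D₁∈s₀₁) E₁∈d₁)) E₁′∈s₂₃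
      E₂≢E₂′ : E₂ ≢ E₂′
      E₂≢E₂′ = ∉⇒≢-points (λ E₂∈s₃₁ → D₂∉d₂ (subst (_I d₂)
        (unique-point (∉⇒≢-lines P₀∉s₃₁ P₀∈s₀₂) E₂∈s₃₁ E₂∈s₀₂ D₂∈s₃₁ D₂∈s₀₂) E₂∈d₂)) E₂′∈s₃₁

    quadrangle-of-quadrilateral :
      (p₀ p₁ p₂ p₃ d₁ d₂ d₃ : Line) →
      IsQuadrilateral Π p₀ p₁ p₂ p₃ → AreDiagonalLines Π p₀ p₁ p₂ p₃ d₁ d₂ d₃ →
      ¬ Concurrent Π d₁ d₂ d₃ →
      ∃[ P₀ ] ∃[ P₁ ] ∃[ P₂ ] ∃[ P₃ ] IsQQConfiguration Π P₀ P₁ P₂ P₃ p₀ p₁ p₂ p₃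
    quadrangle-of-quadrilateral p₀ p₁ p₂ p₃ d₁ d₂ d₃
        quad@(¬p₀p₁p₂ , ¬p₀p₁p₃ , ¬p₀p₂p₃ , ¬p₁p₂p₃)
        diagonals@((V₀₁ , V₂₃ , v₁@(V₀₁∈p₀ , V₀₁∈p₁ , V₂₃∈p₂ , V₂₃∈p₃ , V₀₁∈d₁ , V₂₃∈d₁)) ,
                   (V₀₂ , V₁₃ , v₂@(V₀₂∈p₀ , V₀₂∈p₂ , V₁₃∈p₃ , V₁₃∈p₁ , V₀₂∈d₂ , V₁₃∈d₂)) ,
                   (V₀₃ , V₁₂ , v₃@(V₀₃∈p₀ , V₀₃∈p₃ , V₁₂∈p₁ , V₁₂∈p₂ , V₀₃∈d₃ , V₁₂∈d₃)))
        ¬d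
      with meet d₂ d₃ (nonconcurrent⇒≢ (¬d ∘ concurrent-swapˡ ∘ concurrent-swapʳ) V₀₁∈d₁)
         | meet d₃ d₁ (nonconcurrent⇒≢ (¬d ∘ concurrent-swapʳ ∘ concurrent-swapˡ) V₀₂∈d₂)
         | meet d₁ d₂ (nonconcurrent⇒≢ ¬d V₀₃∈d₃)
    ... | D₁ , D₁∈d₂ , D₁∈d₃ | D₂ , D₂∈d₃ , D₂∈d₁ | D₃ , D₃∈d₁ , D₃∈d₂
      with join D₁ V₂₃ (λ { refl → ¬d (_ , V₂₃∈d₁ , D₁∈d₂ , D₁∈d₃) })
         | join D₁ V₀₁ (λ { refl → ¬d (_ , V₀₁∈d₁ , D₁∈d₂ , D₁∈d₃) })
         | join D₂ V₁₃ (λ { refl → ¬d (_ , D₂∈d₁ , V₁₃∈d₂ , D₂∈d₃) })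
         | join D₂ V₀₂ (λ { refl → ¬d (_ , D₂∈d₁ , V₀₂∈d₂ , D₂∈d₃) })
    ... | a₀₁ , D₁∈a₀₁ , V₂₃∈a₀₁ | a₂₃ , D₁∈a₂₃ , V₀₁∈a₂₃
        | a₀₂ , D₂∈a₀₂ , V₁₃∈a₀₂ | a₁₃ , D₂∈a₁₃ , V₀₂∈a₁₃ =
      let P₀ , P₁ , P₂ , P₃ , (P₀∈a₀₁ , P₀∈a₀₂) , (P₁∈a₀₁ , P₁∈a₁₃) ,
            (P₂∈a₀₂ , P₂∈a₂₃) , (P₃∈a₁₃ , P₃∈a₂₃) , quadrangle =
            quadrangle-of-pencils D₁∈a₀₁ D₁∈a₂₃ D₂∈a₀₂ D₂∈a₁₃ a₀₁≢a₂₃ a₀₂≢a₁₃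
              D₂∉a₀₁ D₂∉a₂₃ D₁∉a₀₂ D₁∉a₁₃
          l₀₃ , P₀∈l₀₃ , P₃∈l₀₃ , D₃∈l₀₃ =
            diagonal-trilateral-axis ¬p₀p₁p₂ ¬p₁p₂p₃ ¬d v₁ v₂ v₃
              D₁∈d₂ D₁∈d₃ D₂∈d₃ D₂∈d₁ D₃∈d₁ D₃∈d₂
              (a₀₁ , a₀₂ , V₂₃∈a₀₁ , D₁∈a₀₁ , V₁₃∈a₀₂ , D₂∈a₀₂ , P₀∈a₀₁ , P₀∈a₀₂)
              (a₂₃ , a₁₃ , D₁∈a₂₃ , V₀₁∈a₂₃ , D₂∈a₁₃ , V₀₂∈a₁₃ , P₃∈a₂₃ , P₃∈a₁₃)
          l₁₂ , P₁∈l₁₂ , P₂∈l₁₂ , D₃∈l₁₂ =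
            diagonal-trilateral-axis (¬p₀p₁p₃ ∘ concurrent-swapˡ) (¬p₀p₂p₃ ∘ concurrent-swapʳ) ¬d
              (V₀₁∈p₁ , V₀₁∈p₀ , V₂₃∈p₃ , V₂₃∈p₂ , V₀₁∈d₁ , V₂₃∈d₁)
              (V₁₃∈p₁ , V₁₃∈p₃ , V₀₂∈p₂ , V₀₂∈p₀ , V₁₃∈d₂ , V₀₂∈d₂)
              (V₁₂∈p₁ , V₁₂∈p₂ , V₀₃∈p₀ , V₀₃∈p₃ , V₁₂∈d₃ , V₀₃∈d₃)
              D₁∈d₂ D₁∈d₃ D₂∈d₃ D₂∈d₁ D₃∈d₁ D₃∈d₂
              (a₀₁ , a₁₃ , V₂₃∈a₀₁ , D₁∈a₀₁ , V₀₂∈a₁₃ , D₂∈a₁₃ , P₁∈a₀₁ , P₁∈a₁₃)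
              (a₂₃ , a₀₂ , D₁∈a₂₃ , V₀₁∈a₂₃ , D₂∈a₀₂ , V₁₃∈a₀₂ , P₂∈a₂₃ , P₂∈a₀₂)
      in P₀ , P₁ , P₂ , P₃ , quadrangle , quad , D₁ , D₂ , D₃ , d₁ , d₂ , d₃ ,
         ( (a₀₁ , a₂₃ , P₀∈a₀₁ , P₁∈a₀₁ , P₂∈a₂₃ , P₃∈a₂₃ , D₁∈a₀₁ , D₁∈a₂₃)
         , (a₀₂ , a₁₃ , P₀∈a₀₂ , P₂∈a₀₂ , P₃∈a₁₃ , P₁∈a₁₃ , D₂∈a₀₂ , D₂∈a₁₃)
         , (l₀₃ , l₁₂ , P₀∈l₀₃ , P₃∈l₀₃ , P₁∈l₁₂ , P₂∈l₁₂ , D₃∈l₀₃ , D₃∈l₁₂) ) ,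
         diagonals , (D₂∈d₁ , D₃∈d₁) , (D₃∈d₂ , D₁∈d₂) , (D₁∈d₃ , D₂∈d₃)
      where
      D₁∉d₁ : ¬ D₁ I d₁
      D₁∉d₁ D₁∈d₁ = ¬d (D₁ , D₁∈d₁ , D₁∈d₂ , D₁∈d₃)
      D₂∉d₂ : ¬ D₂ I d₂
      D₂∉d₂ D₂∈d₂ = ¬d (D₂ , D₂∈d₁ , D₂∈d₂ , D₂∈d₃)
      on-d₃ : D₁ I a → D₂ I a → X I a → X I d₃
      on-d₃ D₁∈a D₂∈a = join-transport (∉⇒≢-points D₁∉d₁ D₂∈d₁) D₁∈a D₂∈a D₁∈d₃ D₂∈d₃
      V₀₁≢V₂₃ : V₀₁ ≢ V₂₃
      V₀₁≢V₂₃ = ∉⇒≢-points (λ V₀₁∈p₂ → ¬p₀p₁p₂ (V₀₁ , V₀₁∈p₀ , V₀₁∈p₁ , V₀₁∈p₂)) V₂₃∈p₂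
      V₀₂≢V₁₃ : V₀₂ ≢ V₁₃
      V₀₂≢V₁₃ = ∉⇒≢-points (λ V₀₂∈p₁ → ¬p₀p₁p₂ (V₀₂ , V₀₂∈p₀ , V₀₂∈p₁ , V₀₂∈p₂)) V₁₃∈p₁
      V₀₃≢V₂₃ : V₀₃ ≢ V₂₃
      V₀₃≢V₂₃ = ∉⇒≢-points (λ V₀₃∈p₂ → ¬p₀p₂p₃ (V₀₃ , V₀₃∈p₀ , V₀₃∈p₂ , V₀₃∈p₃)) V₂₃∈p₂
      V₀₁≢V₀₃ : V₀₁ ≢ V₀₃
      V₀₁≢V₀₃ = ∉⇒≢-points (λ V₀₁∈p₃ → ¬p₀p₁p₃ (V₀₁ , V₀₁∈p₀ , V₀₁∈p₁ , V₀₁∈p₃)) V₀₃∈p₃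
      V₀₂≢V₀₃ : V₀₂ ≢ V₀₃
      V₀₂≢V₀₃ = ∉⇒≢-points (λ V₀₂∈p₃ → ¬p₀p₂p₃ (V₀₂ , V₀₂∈p₀ , V₀₂∈p₂ , V₀₂∈p₃)) V₀₃∈p₃
      V₁₃≢V₁₂ : V₁₃ ≢ V₁₂
      V₁₃≢V₁₂ = ∉⇒≢-points (λ V₁₃∈p₂ → ¬p₁p₂p₃ (V₁₃ , V₁₃∈p₁ , V₁₃∈p₂ , V₁₃∈p₃)) V₁₂∈p₂
      D₂∉a₀₁ : ¬ D₂ I a₀₁
      D₂∉a₀₁ D₂∈a₀₁ = ¬p₁p₂p₃ (V₁₂ , V₁₂∈p₁ , V₁₂∈p₂ , join-transport V₀₃≢V₂₃
        V₀₃∈d₃ (on-d₃ D₁∈a₀₁ D₂∈a₀₁ V₂₃∈a₀₁) V₀₃∈p₃ V₂₃∈p₃ V₁₂∈d₃)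
      D₂∉a₂₃ : ¬ D₂ I a₂₃
      D₂∉a₂₃ D₂∈a₂₃ = ¬p₀p₁p₂ (V₁₂ , join-transport V₀₁≢V₀₃
        (on-d₃ D₁∈a₂₃ D₂∈a₂₃ V₀₁∈a₂₃) V₀₃∈d₃ V₀₁∈p₀ V₀₃∈p₀ V₁₂∈d₃ , V₁₂∈p₁ , V₁₂∈p₂)
      D₁∉a₀₂ : ¬ D₁ I a₀₂
      D₁∉a₀₂ D₁∈a₀₂ = ¬p₀p₁p₃ (V₀₃ , V₀₃∈p₀ , join-transport V₁₃≢V₁₂
        (on-d₃ D₁∈a₀₂ D₂∈a₀₂ V₁₃∈a₀₂) V₁₂∈d₃ V₁₃∈p₁ V₁₂∈p₁ V₀₃∈d₃ , V₀₃∈p₃)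
      D₁∉a₁₃ : ¬ D₁ I a₁₃
      D₁∉a₁₃ D₁∈a₁₃ = ¬p₀p₁p₂ (V₁₂ , join-transport V₀₂≢V₀₃
        (on-d₃ D₁∈a₁₃ D₂∈a₁₃ V₀₂∈a₁₃) V₀₃∈d₃ V₀₂∈p₀ V₀₃∈p₀ V₁₂∈d₃ , V₁₂∈p₁ , V₁₂∈p₂)
      a₀₁≢a₂₃ : a₀₁ ≢ a₂₃
      a₀₁≢a₂₃ = ∉⇒≢-lines (λ V₀₁∈a₀₁ → D₁∉d₁
        (join-transport V₀₁≢V₂₃ V₀₁∈a₀₁ V₂₃∈a₀₁ V₀₁∈d₁ V₂₃∈d₁ D₁∈a₀₁)) V₀₁∈a₂₃
      a₀₂≢a₁₃ : a₀₂ ≢ a₁₃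
      a₀₂≢a₁₃ = ∉⇒≢-lines (λ V₀₂∈a₀₂ → D₂∉d₂
        (join-transport V₀₂≢V₁₃ V₀₂∈a₀₂ V₁₃∈a₀₂ V₀₂∈d₂ V₁₃∈d₂ D₂∈a₀₂)) V₀₂∈a₁₃

mainTheorem2 : {ℓ : Level} (Π : ProjectivePlane ℓ) → Desarguesian Π →
    ((P₀ P₁ P₂ P₃ D₁ D₂ D₃ : ProjectivePlane.Point Π) →
      IsQuadrangle Π P₀ P₁ P₂ P₃ →
      AreDiagonalPoints Π P₀ P₁ P₂ P₃ D₁ D₂ D₃ →
      ¬ Collinear Π D₁ D₂ D₃ →
      ∃[ p₀ ] ∃[ p₁ ] ∃[ p₂ ] ∃[ p₃ ] ∃[ d₁ ] ∃[ d₂ ] ∃[ d₃ ]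
        (IsQuadrilateral Π p₀ p₁ p₂ p₃ ×
         AreDiagonalLines Π p₀ p₁ p₂ p₃ d₁ d₂ d₃ ×
         DiagonalMatch Π D₁ D₂ D₃ d₁ d₂ d₃))
    ×
    ((p₀ p₁ p₂ p₃ d₁ d₂ d₃ : ProjectivePlane.Line Π) →
      IsQuadrilateral Π p₀ p₁ p₂ p₃ →
      AreDiagonalLines Π p₀ p₁ p₂ p₃ d₁ d₂ d₃ →
      ¬ Concurrent Π d₁ d₂ d₃ →
      ∃[ P₀ ] ∃[ P₁ ] ∃[ P₂ ] ∃[ P₃ ]
        IsQQConfiguration Π P₀ P₁ P₂ P₃ p₀ p₁ p₂ p₃)
mainTheorem2 Π desargues =
  quadrilateral-of-quadrangle Π desargues , quadrangle-of-quadrilateral Π desargues
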